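{- Consider an instance of the maintenance scheduling problem (described in the context) with time horizon $T\geqslant 1$. Let $z^*$ be the optimal total throughput and $\tilde z$ the total throughput obtained by scheduling all jobs in the same time period (with maximum flows in each period). Then $\tilde z\geqslant \frac{T-1}{T}z^*$.
   Context: Maintenance scheduling problem: given a directed network $N=(V,A,s,t,u)$ (parallel arcs allowed, so $A$ is a multiset) with source $s$, sink $t$ and nonnegative integer capacities $u_a$, a set $J\subseteq A$ of arcs each of which must be shut down for exactly one of the time periods $[T]=\{1,\dots,T\}$, a schedule assigns to each $a\in J$ a period $\tau(a)\in[T]$. In period $i$, every arc $a\in J$ with $\tau(a)=i$ has capacity $0$, all other arcs have capacity $u_a$, and an $s$-$t$ flow (satisfying capacity constraints and flow conservation at all nodes other than $s,t$) is sent independently in each period. The total throughput is the sum over $i\in[T]$ of the net flow out of $s$ in period $i$; the problem is to choose the schedule and flows maximizing total throughput. "Scheduling all jobs in the same time period" means $\tau$ is constant on $J$.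
   Formalization: The arc flows in every period, and hence the throughputs $z^*$ and $\tilde z$, take values in the rationals. -}

module Defs where

open import Data.Nat using (ℕ; zero; suc)
open import Data.Fin using (Fin; zero; suc; _≟_)
open import Data.Bool using (Bool; true; false; _∧_; if_then_else_)
open import Data.Integer using (+_)
open import Data.Rational using (ℚ; 0ℚ; _+_; _-_; _≤_; _/_)
open import Data.Product using (_×_)
open import Relation.Nullary using (¬_; does)
open import Relation.Binary.PropositionalEquality using (_≡_)

ΣFin : {k : ℕ} → (Fin k → ℚ) → ℚ
ΣFin {zero}  f = 0ℚ
ΣFin {suc k} f = f zero + ΣFin (λ i → f (suc i))

-- A directed network with node set Fin n and arc set Fin m (arcs are
-- indexed, so parallel arcs are allowed), tail/head maps, source s,
-- sink t and nonnegative integer capacities u.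
record Network : Set where
  field
    n m  : ℕ
    tl   : Fin m → Fin n
    hd   : Fin m → Fin n
    s t  : Fin n
    u    : Fin m → ℕ
open Network public

capℚ : (N : Network) → Fin (m N) → ℚ
capℚ N a = + (u N a) / 1

inflow : (N : Network) → (Fin (m N) → ℚ) → Fin (n N) → ℚ
inflow N f v = ΣFin (λ a → if does (hd N a ≟ v) then f a else 0ℚ)

outflow : (N : Network) → (Fin (m N) → ℚ) → Fin (n N) → ℚ
outflow N f v = ΣFin (λ a → if does (tl N a ≟ v) then f a else 0ℚ)

IsFlow : (N : Network) → (Fin (m N) → ℚ) → (Fin (m N) → ℚ) → Set
IsFlow N c f =
  (∀ a → (0ℚ ≤ f a) × (f a ≤ c a)) ×
  (∀ v → ¬ (v ≡ s N) → ¬ (v ≡ t N) → inflow N f v ≡ outflow N f v)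

flowValue : (N : Network) → (Fin (m N) → ℚ) → ℚ
flowValue N f = outflow N f (s N) - inflow N f (s N)

-- Schedule: J ⊆ A given as a Boolean indicator, τ : A → [T]
-- (values of τ off J are irrelevant). Capacity of arc a in period i.
periodCap : (N : Network) (J : Fin (m N) → Bool) {T : ℕ}
            (τ : Fin (m N) → Fin T) (i : Fin T) → Fin (m N) → ℚ
periodCap N J τ i a = if J a ∧ does (τ a ≟ i) then 0ℚ else capℚ N a

FeasibleFlows : (N : Network) (J : Fin (m N) → Bool) {T : ℕ}
                (τ : Fin (m N) → Fin T) → (Fin T → Fin (m N) → ℚ) → Set
FeasibleFlows N J τ f = ∀ i → IsFlow N (periodCap N J τ i) (f i)

throughput : (N : Network) {T : ℕ} → (Fin T → Fin (m N) → ℚ) → ℚ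
throughput N f = ΣFin (λ i → flowValue N (f i))

-- Let M be the largest single-period flow value of the given schedule, attained
-- in period j, so its throughput is at most T·M.  If every job is shut down in period k, every other
-- period has all arcs available, so the flow of period j can be reused in each
-- of them, and the zero flow is used in period k; this gives (T − 1)·M.
module Submission where

open import Defs
open import Data.Nat using (ℕ; _≥_; _∸_)
open import Data.Fin using (Fin)
open import Data.Bool using (Bool)
open import Data.Integer using (+_)
open import Data.Rational using (ℚ; _≤_; _*_; _/_)
open import Data.Product using (Σ; _×_)

open import Data.Nat using (zero; suc)
open import Data.Nat.Properties using (*-identityʳ)
open import Data.Nat.Coprimality as Coprime using (1-coprimeTo)
open import Data.Fin using (zero; suc; _≟_)
open import Data.Bool using (true; false; _∧_; if_then_else_)
open import Data.Rational using (0ℚ; 1ℚ; _+_; _-_)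
open import Data.Rational.Properties
  using (≤-refl; ≤-trans; ≤-reflexive; ≤-total; +-mono-≤; +-identityˡ; *-identityˡ;
         *-zeroˡ; *-distribʳ-+; *-assoc; *-comm; *-monoˡ-≤-nonNeg;
         normalize-coprime; normalize-nonNeg; nonNegative⁻¹; module ≤-Reasoning)
open import Data.Product using (_,_; proj₁; proj₂)
open import Data.Sum using (inj₁; inj₂)
open import Relation.Nullary using (yes; no; does)
open import Relation.Binary.PropositionalEquality
  using (_≡_; refl; sym; trans; cong; cong₂; module ≡-Reasoning)

0≤n/1 : ∀ n → 0ℚ ≤ + n / 1
0≤n/1 n = nonNegative⁻¹ _ {{normalize-nonNeg n 1}}

1+n/1≡suc-n/1 : ∀ n → 1ℚ + + n / 1 ≡ + suc n / 1
1+n/1≡suc-n/1 zero    = refl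
1+n/1≡suc-n/1 (suc n) = trans
  (cong (λ x → 1ℚ + x) (normalize-coprime {suc n} {0} (Coprime.sym (1-coprimeTo (suc n)))))
  (cong (λ k → + suc (suc k) / 1) (*-identityʳ n))

c+n*c≡suc-n*c : ∀ n c → c + (+ n / 1) * c ≡ (+ suc n / 1) * c
c+n*c≡suc-n*c n c = begin
  c + (+ n / 1) * c         ≡⟨ cong (_+ (+ n / 1) * c) (sym (*-identityˡ c)) ⟩
  1ℚ * c + (+ n / 1) * c    ≡⟨ sym (*-distribʳ-+ c 1ℚ (+ n / 1)) ⟩
  (1ℚ + + n / 1) * c        ≡⟨ cong (_* c) (1+n/1≡suc-n/1 n) ⟩
  (+ suc n / 1) * c         ∎
  where open ≡-Reasoning

ΣFin-cong : ∀ {k} {f g : Fin k → ℚ} → (∀ i → f i ≡ g i) → ΣFin f ≡ ΣFin g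
ΣFin-cong {zero}  f≡g = refl
ΣFin-cong {suc k} f≡g = cong₂ _+_ (f≡g zero) (ΣFin-cong (λ i → f≡g (suc i)))

ΣFin-mono : ∀ {k} {f g : Fin k → ℚ} → (∀ i → f i ≤ g i) → ΣFin f ≤ ΣFin g
ΣFin-mono {zero}  f≤g = ≤-refl
ΣFin-mono {suc k} f≤g = +-mono-≤ (f≤g zero) (ΣFin-mono (λ i → f≤g (suc i)))

ΣFin-zero : ∀ {k} {f : Fin k → ℚ} → (∀ i → f i ≡ 0ℚ) → ΣFin f ≡ 0ℚ
ΣFin-zero {zero}  f≡0 = refl
ΣFin-zero {suc k} f≡0 = cong₂ _+_ (f≡0 zero) (ΣFin-zero (λ i → f≡0 (suc i)))

ΣFin-const : ∀ k c → ΣFin {k} (λ _ → c) ≡ (+ k / 1) * c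
ΣFin-const zero    c = sym (*-zeroˡ c)
ΣFin-const (suc k) c = trans (cong (λ x → c + x) (ΣFin-const k c)) (c+n*c≡suc-n*c k c)

ΣFin-const-except : ∀ n (k : Fin (suc n)) c →
  ΣFin (λ i → if does (k ≟ i) then 0ℚ else c) ≡ (+ n / 1) * c
ΣFin-const-except n       zero    c = trans (+-identityˡ _) (ΣFin-const n c)
ΣFin-const-except (suc n) (suc k) c =
  trans (cong (λ x → c + x) (ΣFin-const-except n k c)) (c+n*c≡suc-n*c n c)

argmax : ∀ {n} (v : Fin (suc n) → ℚ) → Σ (Fin (suc n)) (λ j → ∀ i → v i ≤ v j)
argmax {zero}  v = zero , λ { zero → ≤-refl }
argmax {suc n} v with argmax (λ i → v (suc i))
... | j , v≤vj with ≤-total (v zero) (v (suc j))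
...   | inj₁ v0≤ = suc j , λ { zero → v0≤   ; (suc i) → v≤vj i }
...   | inj₂ ≤v0 = zero  , λ { zero → ≤-refl ; (suc i) → ≤-trans (v≤vj i) ≤v0 }

if-0ℚ-0ℚ : ∀ (b : Bool) → (if b then 0ℚ else 0ℚ) ≡ 0ℚ
if-0ℚ-0ℚ true  = refl
if-0ℚ-0ℚ false = refl

module _ (N : Network) where

  zeroFlow : Fin (m N) → ℚ
  zeroFlow _ = 0ℚ

  in-zeroFlow : ∀ v → ΣFin (λ a → if does (hd N a ≟ v) then zeroFlow a else 0ℚ) ≡ 0ℚ
  in-zeroFlow v = ΣFin-zero (λ a → if-0ℚ-0ℚ (does (hd N a ≟ v)))

  out-zeroFlow : ∀ v → ΣFin (λ a → if does (tl N a ≟ v) then zeroFlow a else 0ℚ) ≡ 0ℚ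
  out-zeroFlow v = ΣFin-zero (λ a → if-0ℚ-0ℚ (does (tl N a ≟ v)))

  zeroFlow-isFlow : ∀ {c} → (∀ a → 0ℚ ≤ c a) → IsFlow N c zeroFlow
  zeroFlow-isFlow 0≤c =
    (λ a → ≤-refl , 0≤c a) , (λ v _ _ → trans (in-zeroFlow v) (sym (out-zeroFlow v)))

  flowValue-zeroFlow : flowValue N zeroFlow ≡ 0ℚ
  flowValue-zeroFlow = cong₂ _-_ (out-zeroFlow (s N)) (in-zeroFlow (s N))

  isFlow-mono : ∀ {c c′ f} → (∀ a → c a ≤ c′ a) → IsFlow N c f → IsFlow N c′ f
  isFlow-mono c≤c′ (bounds , conservation) =
    (λ a → proj₁ (bounds a) , ≤-trans (proj₂ (bounds a)) (c≤c′ a)) , conservation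

  module _ (J : Fin (m N) → Bool) {T : ℕ} where

    periodCap-≤-capℚ : ∀ (τ : Fin (m N) → Fin T) i a → periodCap N J τ i a ≤ capℚ N a
    periodCap-≤-capℚ τ i a with J a ∧ does (τ a ≟ i)
    ... | true  = 0≤n/1 (u N a)
    ... | false = ≤-refl

    0≤periodCap : ∀ (τ : Fin (m N) → Fin T) i a → 0ℚ ≤ periodCap N J τ i a
    0≤periodCap τ i a with J a ∧ does (τ a ≟ i)
    ... | true  = ≤-refl
    ... | false = 0≤n/1 (u N a)

    allIn : Fin T → (Fin (m N) → ℚ) → Fin T → Fin (m N) → ℚ
    allIn k h i = if does (k ≟ i) then zeroFlow else h

    allIn-feasible : ∀ k {h} → IsFlow N (capℚ N) h → FeasibleFlows N J (λ _ → k) (allIn k h)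
    allIn-feasible k h-flow i with k ≟ i | 0≤periodCap (λ _ → k) i
    ... | yes _ | 0≤cap = zeroFlow-isFlow 0≤cap
    ... | no  _ | _     = isFlow-mono (λ a → ≤-reflexive (cap-when-open (J a) a)) h-flow
      where
      cap-when-open : ∀ b a → capℚ N a ≡ (if b ∧ false then 0ℚ else capℚ N a)
      cap-when-open true  a = refl
      cap-when-open false a = refl

    flowValue-allIn : ∀ k h i →
      flowValue N (allIn k h i) ≡ (if does (k ≟ i) then 0ℚ else flowValue N h)
    flowValue-allIn k h i with does (k ≟ i)
    ... | true  = flowValue-zeroFlow
    ... | false = refl

proposition7 : (N : Network) (J : Fin (m N) → Bool) (T : ℕ) → T ≥ 1 →
    (τ : Fin (m N) → Fin T) (f : Fin T → Fin (m N) → ℚ) →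
    FeasibleFlows N J τ f →
    (k : Fin T) →
    Σ (Fin T → Fin (m N) → ℚ) (λ g →
      FeasibleFlows N J (λ _ → k) g ×
      ((+ (T ∸ 1) / 1) * throughput N f ≤ (+ T / 1) * throughput N g))
proposition7 N J (suc n) _ τ f f-feasible k = g , allIn-feasible N J k fj-flow , bound
  where
  n′ T′ : ℚ
  n′ = + n / 1
  T′ = + suc n / 1
  value : Fin (suc n) → ℚ
  value i = flowValue N (f i)
  j : Fin (suc n)
  j = proj₁ (argmax value)
  M : ℚ
  M = value j
  g : Fin (suc n) → Fin (m N) → ℚ
  g = allIn N J k (f j)
  fj-flow : IsFlow N (capℚ N) (f j)
  fj-flow = isFlow-mono N (periodCap-≤-capℚ N J τ j) (f-feasible j)
  z≤T′M : throughput N f ≤ T′ * M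
  z≤T′M = ≤-trans (ΣFin-mono (proj₂ (argmax value))) (≤-reflexive (ΣFin-const (suc n) M))
  z̃≡n′M : throughput N g ≡ n′ * M
  z̃≡n′M = trans (ΣFin-cong (flowValue-allIn N J k (f j))) (ΣFin-const-except n k M)
  bound : n′ * throughput N f ≤ T′ * throughput N g
  bound = begin
    n′ * throughput N f    ≤⟨ *-monoˡ-≤-nonNeg n′ {{normalize-nonNeg n 1}} z≤T′M ⟩
    n′ * (T′ * M)          ≡⟨ sym (*-assoc n′ T′ M) ⟩
    (n′ * T′) * M          ≡⟨ cong (_* M) (*-comm n′ T′) ⟩
    (T′ * n′) * M          ≡⟨ *-assoc T′ n′ M ⟩
    T′ * (n′ * M)          ≡⟨ cong (T′ *_) (sym z̃≡n′M) ⟩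
    T′ * throughput N g    ∎
    where open ≤-Reasoning
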